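{- Let $D = \{i,j,k\}$ be a set of positive integers with $\gcd(i,j,k) = 1$, and let $d = \gcd(i,j)$. Suppose $\frac{i}{d} + \frac{j}{d} = 2x+1$ for an integer $x$, and $d \geq 2x$. Then $\kappa(D) = \frac{x}{2x+1}$.
   Context: For a real $x$, $\|x\|$ denotes the distance from $x$ to the nearest integer, and for a set $D$ of positive integers $\kappa(D) = \sup_{t \in \mathbb{R}} \min_{d \in D} \|td\|$.
   Formalization: The parameter t in the supremum defining κ(D) ranges over the rationals instead of the reals. -}

module Defs where

open import Data.Nat using (ℕ)
open import Data.Integer using (ℤ; +_)
open import Data.Rational using (ℚ; _/_; _-_; _⊓_; _*_; _<_; _≤_; floor; ceiling; Positive)
open import Data.Product using (Σ; _×_)

ℤ→ℚ : ℤ → ℚ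
ℤ→ℚ z = z / 1

ℕ→ℚ : ℕ → ℚ
ℕ→ℚ n = (+ n) / 1

‖_‖ : ℚ → ℚ
‖ q ‖ = (q - ℤ→ℚ (floor q)) ⊓ (ℤ→ℚ (ceiling q) - q)

minDist : ℕ → ℕ → ℕ → ℚ → ℚ
minDist i j k t = (‖ t * ℕ→ℚ i ‖ ⊓ ‖ t * ℕ→ℚ j ‖) ⊓ ‖ t * ℕ→ℚ k ‖

-- κ({i,j,k}) = v, i.e. v is the supremum of t ↦ minDist i j k t
-- (t ranging over ℚ)
IsKappa : ℕ → ℕ → ℕ → ℚ → Set
IsKappa i j k v =
  ((t : ℚ) → minDist i j k t ≤ v) ×
  ((ε : ℚ) → Positive ε → Σ ℚ λ t → v - ε < minDist i j k t)

{-# OPTIONS --safe #-}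
module Submission where

-- Write i = a d and j = b d, so that a + b = 2x + 1, gcd(a, b) = 1 and gcd(k, d) = 1, and put
-- v = x/(2x+1).
--
-- Upper bound: with s = t d, if ‖s a‖ and ‖s b‖ both exceeded v, then for n = ⌊s a⌋ and m = ⌊s b⌋
-- the identity b (s a − n) + a (m + 1 − s b) = a (m + 1) − b n would give x + b n < a (m + 1), and
-- symmetrically x + a m < b (n + 1); adding the two contradicts a + b = 2x + 1 in the integers.
--
-- Lower bound: take T ≡ x a⁻¹ (mod 2x+1), so that T a ≡ x and T b ≡ x + 1 (mod 2x+1).  Shifting T
-- by multiples of 2x+1 moves T k freely among its residues modulo (2x+1) d, since k is invertible
-- modulo d; the window [x d, x d + d] contains d + 1 ≥ 2x + 1 consecutive residues, so T can be
-- chosen with T k in it.  Then t = T/((2x+1) d) has ‖t i‖, ‖t j‖, ‖t k‖ ≥ v.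

open import Defs
open import Data.Nat using (ℕ; suc; _*_; _+_; _≤_; _≥_; NonZero)
open import Data.Nat.GCD using (gcd)
open import Data.Integer using (+_)
open import Data.Rational using (_/_)
open import Relation.Binary.PropositionalEquality using (_≡_)

open import Data.Empty using (⊥; ⊥-elim)
open import Data.List using (_∷_; [])
open import Data.Maybe using (just; nothing)
open import Data.Product using (_×_; _,_; ∃-syntax; ∃₂)
open import Data.Sum using (inj₁)
open import Level using (0ℓ)
open import Relation.Binary.PropositionalEquality
  using (refl; sym; trans; cong; cong₂; subst; subst₂; module ≡-Reasoning)

import Data.Nat as ℕ
import Data.Nat.Properties as ℕP
open import Data.Nat.Coprimality
  using (Coprime; 1-coprimeTo; coprime-Bézout; coprime-/gcd; gcd≡1⇒coprime) renaming (sym to coprime-sym)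
open import Data.Nat.DivMod using (m/n*n≡m)
open import Data.Nat.GCD
  using (module Bézout; gcd-comm; gcd[m,n]∣m; gcd[m,n]∣n; gcd[m,n]≢0; m/gcd[m,n]≢0; n/gcd[m,n]≢0)
open import Data.Nat.Tactic.RingSolver using () renaming (solve to ℕ-solve)
open import Data.Integer as ℤ using (ℤ; 0ℤ; 1ℤ; ∣_∣)
import Data.Integer.DivMod as ℤ
import Data.Integer.Properties as ℤP
open import Data.Integer.Tactic.RingSolver using (solve; solve-∀)
open import Data.Rational as ℚ using (ℚ; mkℚ; floor; ceiling; 0ℚ)
import Data.Rational.Properties as ℚP
open import Data.Rational.Unnormalised as ℚᵘ using (mkℚᵘ)
import Data.Rational.Unnormalised.Properties as ℚᵘP
open import Tactic.RingSolver.Core.AlmostCommutativeRing using (AlmostCommutativeRing; fromCommutativeRing)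
import Tactic.RingSolver as RingSolver

-- Recognising 0ℚ lets the solver discard cancelled monomials.
ℚ-ring : AlmostCommutativeRing 0ℓ 0ℓ
ℚ-ring = fromCommutativeRing ℚP.+-*-commutativeRing λ { (mkℚ (+ 0) 0 _) → just refl ; _ → nothing }

neg-involutive : ∀ p → ℚ.- (ℚ.- p) ≡ p
neg-involutive p = RingSolver.solve (p ∷ []) ℚ-ring

p<p+q : ∀ {p q} → 0ℚ ℚ.< q → p ℚ.< p ℚ.+ q
p<p+q {p} 0<q = subst (ℚ._< p ℚ.+ _) (ℚP.+-identityʳ p) (ℚP.+-monoʳ-< p 0<q)

p+q≤r⇒q≤r-p : ∀ {p q r} → p ℚ.+ q ℚ.≤ r → q ℚ.≤ r ℚ.- p
p+q≤r⇒q≤r-p {p} {q} {r} p+q≤r = begin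
  q              ≡⟨ RingSolver.solve (p ∷ q ∷ []) ℚ-ring ⟩
  p ℚ.+ q ℚ.- p  ≤⟨ ℚP.+-monoˡ-≤ (ℚ.- p) p+q≤r ⟩
  r ℚ.- p        ∎
  where open ℚP.≤-Reasoning

-- ℤ→ℚ z = z / 1 normalises through a gcd, which is stuck on a variable z; the arithmetic of ℚ
-- computes on the normal form fromℤ z instead.
fromℤ : ℤ → ℚ
fromℤ z = mkℚ z 0 (coprime-sym (1-coprimeTo ∣ z ∣))

ℤ→ℚ≡fromℤ : ∀ z → ℤ→ℚ z ≡ fromℤ z
ℤ→ℚ≡fromℤ z = ℚP.fromℚᵘ-toℚᵘ (fromℤ z)

ℤ→ℚ-homo-+ : ∀ a b → ℤ→ℚ (a ℤ.+ b) ≡ ℤ→ℚ a ℚ.+ ℤ→ℚ b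
ℤ→ℚ-homo-+ a b = begin
  ℤ→ℚ (a ℤ.+ b)                 ≡⟨ cong₂ (λ p q → ℤ→ℚ (p ℤ.+ q)) (ℤP.*-identityʳ a) (ℤP.*-identityʳ b) ⟨
  ℤ→ℚ (a ℤ.* 1ℤ ℤ.+ b ℤ.* 1ℤ)  ≡⟨⟩
  fromℤ a ℚ.+ fromℤ b           ≡⟨ cong₂ ℚ._+_ (ℤ→ℚ≡fromℤ a) (ℤ→ℚ≡fromℤ b) ⟨
  ℤ→ℚ a ℚ.+ ℤ→ℚ b              ∎
  where open ≡-Reasoning

ℤ→ℚ-homo-* : ∀ a b → ℤ→ℚ (a ℤ.* b) ≡ ℤ→ℚ a ℚ.* ℤ→ℚ b
ℤ→ℚ-homo-* a b = sym (cong₂ ℚ._*_ (ℤ→ℚ≡fromℤ a) (ℤ→ℚ≡fromℤ b))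

ℤ→ℚ-homo‿- : ∀ a → ℤ→ℚ (ℤ.- a) ≡ ℚ.- ℤ→ℚ a
ℤ→ℚ-homo‿- a = trans (ℤ→ℚ≡fromℤ (ℤ.- a)) (trans (fromℤ-homo‿- a) (cong ℚ.-_ (sym (ℤ→ℚ≡fromℤ a))))
  where
  fromℤ-homo‿- : ∀ a → fromℤ (ℤ.- a) ≡ ℚ.- fromℤ a
  fromℤ-homo‿- (+ 0)       = refl
  fromℤ-homo‿- ℤ.+[1+ _ ] = refl
  fromℤ-homo‿- ℤ.-[1+ _ ] = refl

ℕ→ℚ-homo-* : ∀ m n → ℕ→ℚ (m * n) ≡ ℕ→ℚ m ℚ.* ℕ→ℚ n
ℕ→ℚ-homo-* m n = trans (cong ℤ→ℚ (ℤP.pos-* m n)) (ℤ→ℚ-homo-* (+ m) (+ n))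

ℤ→ℚ-mono-≤ : ∀ {a b} → a ℤ.≤ b → ℤ→ℚ a ℚ.≤ ℤ→ℚ b
ℤ→ℚ-mono-≤ {a} {b} a≤b = subst₂ ℚ._≤_ (sym (ℤ→ℚ≡fromℤ a)) (sym (ℤ→ℚ≡fromℤ b))
  (ℚ.*≤* (subst₂ ℤ._≤_ (sym (ℤP.*-identityʳ a)) (sym (ℤP.*-identityʳ b)) a≤b))

ℤ→ℚ-cancel-< : ∀ {a b} → ℤ→ℚ a ℚ.< ℤ→ℚ b → a ℤ.< b
ℤ→ℚ-cancel-< {a} {b} a<b with subst₂ ℚ._<_ (ℤ→ℚ≡fromℤ a) (ℤ→ℚ≡fromℤ b) a<b
... | ℚ.*<* a*1<b*1 = subst₂ ℤ._<_ (ℤP.*-identityʳ a) (ℤP.*-identityʳ b) a*1<b*1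

n*[z/n]≡z : ∀ z n .{{_ : ℕ.NonZero n}} → ℕ→ℚ n ℚ.* (z / n) ≡ ℤ→ℚ z
n*[z/n]≡z z n@(suc n-1) = ℚP.toℚᵘ-injective (begin
  ℚ.toℚᵘ (ℕ→ℚ n ℚ.* (z / n))          ≈⟨ ℚP.toℚᵘ-homo-* (ℕ→ℚ n) (z / n) ⟩
  ℚ.toℚᵘ (ℕ→ℚ n) ℚᵘ.* ℚ.toℚᵘ (z / n)  ≈⟨ ℚᵘP.*-cong (ℚP.toℚᵘ-fromℚᵘ (mkℚᵘ (+ n) 0))
                                                      (ℚP.toℚᵘ-fromℚᵘ (mkℚᵘ z n-1)) ⟩
  mkℚᵘ (+ n) 0 ℚᵘ.* mkℚᵘ z n-1        ≈⟨ ℚᵘ.*≡* (cancel (+ n) z) ⟩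
  mkℚᵘ z 0                            ≈⟨ ℚP.toℚᵘ-fromℚᵘ (mkℚᵘ z 0) ⟨
  ℚ.toℚᵘ (ℤ→ℚ z)                      ∎)
  where
  open ℚᵘP.≃-Reasoning
  cancel : ∀ N z → N ℤ.* z ℤ.* 1ℤ ≡ z ℤ.* (1ℤ ℤ.* N)
  cancel = solve-∀

floor-≤ : ∀ r → ℤ→ℚ (floor r) ℚ.≤ r
floor-≤ r@(mkℚ n d-1 _) = subst (ℚ._≤ r) (sym (ℤ→ℚ≡fromℤ (floor r)))
  (ℚ.*≤* (subst (floor r ℤ.* + suc d-1 ℤ.≤_) (sym (ℤP.*-identityʳ n)) (ℤ.[n/d]*d≤n n (+ suc d-1))))

<-suc-floor : ∀ r → r ℚ.< ℤ→ℚ (ℤ.suc (floor r))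
<-suc-floor r@(mkℚ n d-1 _) = subst (r ℚ.<_) (sym (ℤ→ℚ≡fromℤ (ℤ.suc (floor r))))
  (ℚ.*<* (subst₂ ℤ._<_ (sym (ℤP.*-identityʳ n))
    (cong (λ q → ℤ.suc q ℤ.* + suc d-1) (sym (ℤ.div-pos-is-/ℕ n (suc d-1))))
    (ℤ.n<s[n/ℕd]*d n (suc d-1))))

floor-greatest : ∀ {n} r → ℤ→ℚ n ℚ.≤ r → n ℤ.≤ floor r
floor-greatest {n} r n≤r = subst (n ℤ.≤_) (ℤP.pred-suc (floor r))
  (ℤP.i<j⇒i≤pred[j] (ℤ→ℚ-cancel-< {n} {ℤ.suc (floor r)} (ℚP.≤-<-trans n≤r (<-suc-floor r))))

≤-ceiling : ∀ r → r ℚ.≤ ℤ→ℚ (ceiling r)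
≤-ceiling r@(mkℚ _ _ _) = begin
  r                        ≡⟨ neg-involutive r ⟨
  ℚ.- (ℚ.- r)              ≤⟨ ℚP.neg-antimono-≤ (floor-≤ (ℚ.- r)) ⟩
  ℚ.- ℤ→ℚ (floor (ℚ.- r))  ≡⟨ ℤ→ℚ-homo‿- (floor (ℚ.- r)) ⟨
  ℤ→ℚ (ceiling r)          ∎
  where open ℚP.≤-Reasoning

ceiling-least : ∀ {n} r → r ℚ.≤ ℤ→ℚ n → ceiling r ℤ.≤ n
ceiling-least {n} r@(mkℚ _ _ _) r≤n = subst (ceiling r ℤ.≤_) (ℤP.neg-involutive n)
  (ℤP.neg-mono-≤ (floor-greatest (ℚ.- r)
    (subst (ℚ._≤ ℚ.- r) (sym (ℤ→ℚ-homo‿- n)) (ℚP.neg-antimono-≤ r≤n))))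

‖‖≤-floor : ∀ r → ‖ r ‖ ℚ.≤ r ℚ.- ℤ→ℚ (floor r)
‖‖≤-floor r = ℚP.p⊓q≤p (r ℚ.- ℤ→ℚ (floor r)) (ℤ→ℚ (ceiling r) ℚ.- r)

‖‖≤-suc-floor : ∀ r → ‖ r ‖ ℚ.≤ ℤ→ℚ (ℤ.suc (floor r)) ℚ.- r
‖‖≤-suc-floor r = ℚP.≤-trans (ℚP.p⊓q≤q (r ℚ.- ℤ→ℚ (floor r)) (ℤ→ℚ (ceiling r) ℚ.- r))
  (ℚP.+-monoˡ-≤ (ℚ.- r) (ℤ→ℚ-mono-≤ (ceiling-least {ℤ.suc (floor r)} r (ℚP.<⇒≤ (<-suc-floor r)))))

≤‖‖ : ∀ {v r} n → 0ℚ ℚ.< v → ℤ→ℚ n ℚ.+ v ℚ.≤ r → r ℚ.+ v ℚ.≤ ℤ→ℚ (ℤ.suc n) → v ℚ.≤ ‖ r ‖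
≤‖‖ {v} {r} n 0<v n+v≤r r+v≤n+1 = ℚP.⊓-glb
  (ℚP.≤-trans (p+q≤r⇒q≤r-p n+v≤r) (ℚP.+-monoʳ-≤ r (ℚP.neg-antimono-≤ (ℤ→ℚ-mono-≤ floor≤n))))
  (ℚP.≤-trans (p+q≤r⇒q≤r-p r+v≤n+1) (ℚP.+-monoˡ-≤ (ℚ.- r) (ℤ→ℚ-mono-≤ n+1≤ceiling)))
  where
  floor≤n : floor r ℤ.≤ n
  floor≤n = subst (floor r ℤ.≤_) (ℤP.pred-suc n) (ℤP.i<j⇒i≤pred[j] (ℤ→ℚ-cancel-< {floor r} {ℤ.suc n}
    (ℚP.≤-<-trans (floor-≤ r) (ℚP.<-≤-trans (p<p+q 0<v) r+v≤n+1))))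
  n+1≤ceiling : ℤ.suc n ℤ.≤ ceiling r
  n+1≤ceiling = ℤP.i<j⇒suc[i]≤j (ℤ→ℚ-cancel-< {n} {ceiling r}
    (ℚP.<-≤-trans (ℚP.<-≤-trans (p<p+q 0<v) n+v≤r) (≤-ceiling r)))

-- The s-terms cancel: B (s A − p) + A (q − s B) = A q − B p.
cross-bound : ∀ {A B s v p q} .{{_ : ℚ.Positive A}} .{{_ : ℚ.Positive B}} →
              v ℚ.< s ℚ.* A ℚ.- p → v ℚ.< q ℚ.- s ℚ.* B → (A ℚ.+ B) ℚ.* v ℚ.+ B ℚ.* p ℚ.< A ℚ.* q
cross-bound {A} {B} {s} {v} {p} {q} v<sA-p v<q-sB = begin-strict
  (A ℚ.+ B) ℚ.* v ℚ.+ B ℚ.* p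
    ≡⟨ RingSolver.solve (A ∷ B ∷ v ∷ p ∷ []) ℚ-ring ⟩
  B ℚ.* v ℚ.+ A ℚ.* v ℚ.+ B ℚ.* p
    <⟨ ℚP.+-monoˡ-< (B ℚ.* p) (ℚP.+-mono-< (ℚP.*-monoʳ-<-pos B v<sA-p) (ℚP.*-monoʳ-<-pos A v<q-sB)) ⟩
  B ℚ.* (s ℚ.* A ℚ.- p) ℚ.+ A ℚ.* (q ℚ.- s ℚ.* B) ℚ.+ B ℚ.* p
    ≡⟨ RingSolver.solve (A ∷ B ∷ s ∷ p ∷ q ∷ []) ℚ-ring ⟩
  A ℚ.* q ∎
  where open ℚP.≤-Reasoning

floor-cross-bound : ∀ {a b : ℕ} .{{_ : ℕ.NonZero a}} .{{_ : ℕ.NonZero b}} {x s v} →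
                    (ℕ→ℚ a ℚ.+ ℕ→ℚ b) ℚ.* v ≡ ℤ→ℚ x →
                    v ℚ.< ‖ s ℚ.* ℕ→ℚ a ‖ → v ℚ.< ‖ s ℚ.* ℕ→ℚ b ‖ →
                    x ℤ.+ + b ℤ.* floor (s ℚ.* ℕ→ℚ a) ℤ.< + a ℤ.* ℤ.suc (floor (s ℚ.* ℕ→ℚ b))
floor-cross-bound {a} {b} {x} {s} {v} [a+b]v≡x v<‖sa‖ v<‖sb‖ =
  ℤ→ℚ-cancel-< {x ℤ.+ + b ℤ.* n} {+ a ℤ.* ℤ.suc m} (begin-strict
    ℤ→ℚ (x ℤ.+ + b ℤ.* n)             ≡⟨ ℤ→ℚ-homo-+ x (+ b ℤ.* n) ⟩
    ℤ→ℚ x ℚ.+ ℤ→ℚ (+ b ℤ.* n)         ≡⟨ cong₂ ℚ._+_ (sym [a+b]v≡x) (ℤ→ℚ-homo-* (+ b) n) ⟩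
    (A ℚ.+ B) ℚ.* v ℚ.+ B ℚ.* ℤ→ℚ n    <⟨ cross-bound {A} {B} {s} {v} {ℤ→ℚ n} {ℤ→ℚ (ℤ.suc m)}
                                          (ℚP.<-≤-trans v<‖sa‖ (‖‖≤-floor (s ℚ.* A)))
                                          (ℚP.<-≤-trans v<‖sb‖ (‖‖≤-suc-floor (s ℚ.* B))) ⟩
    A ℚ.* ℤ→ℚ (ℤ.suc m)               ≡⟨ ℤ→ℚ-homo-* (+ a) (ℤ.suc m) ⟨
    ℤ→ℚ (+ a ℤ.* ℤ.suc m)             ∎)
  where
  open ℚP.≤-Reasoning
  A = ℕ→ℚ a
  B = ℕ→ℚ b
  n = floor (s ℚ.* A)
  m = floor (s ℚ.* B)
  instance
    A-pos : ℚ.Positive A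
    A-pos = ℚP.normalize-pos a 1
    B-pos : ℚ.Positive B
    B-pos = ℚP.normalize-pos b 1

cross-bounds-incompatible : ∀ {x a b n m} → a ℤ.+ b ≡ x ℤ.+ 1ℤ ℤ.+ x →
                            x ℤ.+ b ℤ.* n ℤ.< a ℤ.* ℤ.suc m → x ℤ.+ a ℤ.* m ℤ.< b ℤ.* ℤ.suc n → ⊥
cross-bounds-incompatible {x} {a} {b} {n} {m} a+b≡2x+1 x+bn<a[m+1] x+am<b[n+1] =
  ℤP.<-irrefl refl (ℤP.suc[i]≤j⇒i<j (begin
    1ℤ ℤ.+ (a ℤ.+ b ℤ.+ (a ℤ.* m ℤ.+ b ℤ.* n))
      ≡⟨ cong (λ c → 1ℤ ℤ.+ (c ℤ.+ (a ℤ.* m ℤ.+ b ℤ.* n))) a+b≡2x+1 ⟩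
    1ℤ ℤ.+ (x ℤ.+ 1ℤ ℤ.+ x ℤ.+ (a ℤ.* m ℤ.+ b ℤ.* n))
      ≡⟨ solve (x ∷ a ∷ b ∷ n ∷ m ∷ []) ⟩
    (1ℤ ℤ.+ (x ℤ.+ b ℤ.* n)) ℤ.+ (1ℤ ℤ.+ (x ℤ.+ a ℤ.* m))
      ≤⟨ ℤP.+-mono-≤ (ℤP.i<j⇒suc[i]≤j x+bn<a[m+1]) (ℤP.i<j⇒suc[i]≤j x+am<b[n+1]) ⟩
    a ℤ.* (1ℤ ℤ.+ m) ℤ.+ b ℤ.* (1ℤ ℤ.+ n)
      ≡⟨ solve (a ∷ b ∷ n ∷ m ∷ []) ⟩
    a ℤ.+ b ℤ.+ (a ℤ.* m ℤ.+ b ℤ.* n) ∎))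
  where open ℤP.≤-Reasoning

+[2x+1]≡x+1+x : ∀ x → + suc (2 * x) ≡ + x ℤ.+ 1ℤ ℤ.+ + x
+[2x+1]≡x+1+x x = begin
  + suc (2 * x)       ≡⟨ cong +_ (ℕ-solve (x ∷ [])) ⟩
  + (x + 1 + x)       ≡⟨ ℤP.pos-+ (x + 1) x ⟩
  + (x + 1) ℤ.+ + x   ≡⟨ cong (ℤ._+ + x) (ℤP.pos-+ x 1) ⟩
  + x ℤ.+ 1ℤ ℤ.+ + x  ∎
  where open ≡-Reasoning

‖sa‖⊓‖sb‖≤ : ∀ {a b x} .{{_ : ℕ.NonZero a}} .{{_ : ℕ.NonZero b}} → a + b ≡ suc (2 * x) →
             ∀ s → ‖ s ℚ.* ℕ→ℚ a ‖ ℚ.⊓ ‖ s ℚ.* ℕ→ℚ b ‖ ℚ.≤ + x / suc (2 * x)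
‖sa‖⊓‖sb‖≤ {a} {b} {x} a+b≡2x+1 s = ℚP.≮⇒≥ λ v<min →
  cross-bounds-incompatible {+ x} {+ a} {+ b} {floor (s ℚ.* ℕ→ℚ a)} {floor (s ℚ.* ℕ→ℚ b)} +a+b≡2x+1
    (floor-cross-bound {x = + x} {s} [a+b]v≡x (below-‖sa‖ v<min) (below-‖sb‖ v<min))
    (floor-cross-bound {x = + x} {s} [b+a]v≡x (below-‖sb‖ v<min) (below-‖sa‖ v<min))
  where
  v = + x / suc (2 * x)
  ‖sa‖ = ‖ s ℚ.* ℕ→ℚ a ‖
  ‖sb‖ = ‖ s ℚ.* ℕ→ℚ b ‖
  below-‖sa‖ : v ℚ.< ‖sa‖ ℚ.⊓ ‖sb‖ → v ℚ.< ‖sa‖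
  below-‖sa‖ v<min = ℚP.<-≤-trans v<min (ℚP.p⊓q≤p ‖sa‖ ‖sb‖)
  below-‖sb‖ : v ℚ.< ‖sa‖ ℚ.⊓ ‖sb‖ → v ℚ.< ‖sb‖
  below-‖sb‖ v<min = ℚP.<-≤-trans v<min (ℚP.p⊓q≤q ‖sa‖ ‖sb‖)
  +a+b≡+[2x+1] : + a ℤ.+ + b ≡ + suc (2 * x)
  +a+b≡+[2x+1] = trans (sym (ℤP.pos-+ a b)) (cong +_ a+b≡2x+1)
  +a+b≡2x+1 : + a ℤ.+ + b ≡ + x ℤ.+ 1ℤ ℤ.+ + x
  +a+b≡2x+1 = trans +a+b≡+[2x+1] (+[2x+1]≡x+1+x x)
  [a+b]v≡x : (ℕ→ℚ a ℚ.+ ℕ→ℚ b) ℚ.* v ≡ ℤ→ℚ (+ x)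
  [a+b]v≡x = begin
    (ℕ→ℚ a ℚ.+ ℕ→ℚ b) ℚ.* v  ≡⟨ cong (ℚ._* v) (ℤ→ℚ-homo-+ (+ a) (+ b)) ⟨
    ℤ→ℚ (+ a ℤ.+ + b) ℚ.* v  ≡⟨ cong (λ z → ℤ→ℚ z ℚ.* v) +a+b≡+[2x+1] ⟩
    ℕ→ℚ (suc (2 * x)) ℚ.* v  ≡⟨ n*[z/n]≡z (+ x) (suc (2 * x)) ⟩
    ℤ→ℚ (+ x)                ∎
    where open ≡-Reasoning
  [b+a]v≡x : (ℕ→ℚ b ℚ.+ ℕ→ℚ a) ℚ.* v ≡ ℤ→ℚ (+ x)
  [b+a]v≡x = trans (cong (ℚ._* v) (ℚP.+-comm (ℕ→ℚ b) (ℕ→ℚ a))) [a+b]v≡x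

InWindow : ℤ → ℤ → ℤ → Set
InWindow N V P = ∃[ n ] (N ℤ.* n ℤ.+ V ℤ.≤ P × P ℤ.+ V ℤ.≤ N ℤ.* ℤ.suc n)

inWindow : ∀ {N V W ρ P} n → N ≡ V ℤ.+ W ℤ.+ V → 0ℤ ℤ.≤ ρ → ρ ℤ.≤ W →
           P ≡ N ℤ.* n ℤ.+ V ℤ.+ ρ → InWindow N V P
inWindow {N} {V} {W} {ρ} n N≡V+W+V 0≤ρ ρ≤W refl = n , lower , upper
  where
  open ℤP.≤-Reasoning
  lower : N ℤ.* n ℤ.+ V ℤ.≤ N ℤ.* n ℤ.+ V ℤ.+ ρ
  lower = begin
    N ℤ.* n ℤ.+ V         ≡⟨ ℤP.+-identityʳ (N ℤ.* n ℤ.+ V) ⟨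
    N ℤ.* n ℤ.+ V ℤ.+ 0ℤ  ≤⟨ ℤP.+-monoʳ-≤ (N ℤ.* n ℤ.+ V) 0≤ρ ⟩
    N ℤ.* n ℤ.+ V ℤ.+ ρ   ∎
  upper : N ℤ.* n ℤ.+ V ℤ.+ ρ ℤ.+ V ℤ.≤ N ℤ.* ℤ.suc n
  upper = begin
    N ℤ.* n ℤ.+ V ℤ.+ ρ ℤ.+ V    ≤⟨ ℤP.+-monoˡ-≤ V (ℤP.+-monoʳ-≤ (N ℤ.* n ℤ.+ V) ρ≤W) ⟩
    N ℤ.* n ℤ.+ V ℤ.+ W ℤ.+ V    ≡⟨ solve (N ∷ n ∷ V ∷ W ∷ []) ⟩
    N ℤ.* n ℤ.+ (V ℤ.+ W ℤ.+ V)  ≡⟨ cong (λ M → N ℤ.* n ℤ.+ M) N≡V+W+V ⟨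
    N ℤ.* n ℤ.+ N                ≡⟨ solve (N ∷ n ∷ []) ⟩
    N ℤ.* (1ℤ ℤ.+ n)             ∎

inWindow-scale : ∀ {N V P} D .{{_ : ℤ.NonNegative D}} →
                 InWindow N V P → InWindow (N ℤ.* D) (V ℤ.* D) (P ℤ.* D)
inWindow-scale {N} {V} {P} D (n , Nn+V≤P , P+V≤N[n+1]) = n , lower , upper
  where
  open ℤP.≤-Reasoning
  lower : N ℤ.* D ℤ.* n ℤ.+ V ℤ.* D ℤ.≤ P ℤ.* D
  lower = begin
    N ℤ.* D ℤ.* n ℤ.+ V ℤ.* D  ≡⟨ solve (N ∷ D ∷ n ∷ V ∷ []) ⟩
    (N ℤ.* n ℤ.+ V) ℤ.* D      ≤⟨ ℤP.*-monoʳ-≤-nonNeg D Nn+V≤P ⟩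
    P ℤ.* D                    ∎
  upper : P ℤ.* D ℤ.+ V ℤ.* D ℤ.≤ N ℤ.* D ℤ.* ℤ.suc n
  upper = begin
    P ℤ.* D ℤ.+ V ℤ.* D        ≡⟨ solve (P ∷ D ∷ V ∷ []) ⟩
    (P ℤ.+ V) ℤ.* D            ≤⟨ ℤP.*-monoʳ-≤-nonNeg D P+V≤N[n+1] ⟩
    N ℤ.* (1ℤ ℤ.+ n) ℤ.* D     ≡⟨ solve (N ∷ D ∷ n ∷ []) ⟩
    N ℤ.* D ℤ.* (1ℤ ℤ.+ n)     ∎

≤‖‖-inWindow : ∀ {N} .{{_ : ℕ.NonZero N}} {V P v r} → 0ℚ ℚ.< v →
               ℕ→ℚ N ℚ.* v ≡ ℤ→ℚ V → ℕ→ℚ N ℚ.* r ≡ ℤ→ℚ P → InWindow (+ N) V P → v ℚ.≤ ‖ r ‖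
≤‖‖-inWindow {N} {V} {P} {v} {r} 0<v Nv≡V Nr≡P (n , Nn+V≤P , P+V≤N[n+1]) =
  ≤‖‖ n 0<v (ℚP.*-cancelˡ-≤-pos (ℕ→ℚ N) lower) (ℚP.*-cancelˡ-≤-pos (ℕ→ℚ N) upper)
  where
  instance
    N-pos : ℚ.Positive (ℕ→ℚ N)
    N-pos = ℚP.normalize-pos N 1
  open ℚP.≤-Reasoning
  lower : ℕ→ℚ N ℚ.* (ℤ→ℚ n ℚ.+ v) ℚ.≤ ℕ→ℚ N ℚ.* r
  lower = begin
    ℕ→ℚ N ℚ.* (ℤ→ℚ n ℚ.+ v)          ≡⟨ ℚP.*-distribˡ-+ (ℕ→ℚ N) (ℤ→ℚ n) v ⟩
    ℕ→ℚ N ℚ.* ℤ→ℚ n ℚ.+ ℕ→ℚ N ℚ.* v  ≡⟨ cong₂ ℚ._+_ (sym (ℤ→ℚ-homo-* (+ N) n)) Nv≡V ⟩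
    ℤ→ℚ (+ N ℤ.* n) ℚ.+ ℤ→ℚ V       ≡⟨ ℤ→ℚ-homo-+ (+ N ℤ.* n) V ⟨
    ℤ→ℚ (+ N ℤ.* n ℤ.+ V)           ≤⟨ ℤ→ℚ-mono-≤ Nn+V≤P ⟩
    ℤ→ℚ P                           ≡⟨ Nr≡P ⟨
    ℕ→ℚ N ℚ.* r                     ∎
  upper : ℕ→ℚ N ℚ.* (r ℚ.+ v) ℚ.≤ ℕ→ℚ N ℚ.* ℤ→ℚ (ℤ.suc n)
  upper = begin
    ℕ→ℚ N ℚ.* (r ℚ.+ v)              ≡⟨ ℚP.*-distribˡ-+ (ℕ→ℚ N) r v ⟩
    ℕ→ℚ N ℚ.* r ℚ.+ ℕ→ℚ N ℚ.* v      ≡⟨ cong₂ ℚ._+_ Nr≡P Nv≡V ⟩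
    ℤ→ℚ P ℚ.+ ℤ→ℚ V                 ≡⟨ ℤ→ℚ-homo-+ P V ⟨
    ℤ→ℚ (P ℤ.+ V)                   ≤⟨ ℤ→ℚ-mono-≤ P+V≤N[n+1] ⟩
    ℤ→ℚ (+ N ℤ.* ℤ.suc n)           ≡⟨ ℤ→ℚ-homo-* (+ N) (ℤ.suc n) ⟩
    ℕ→ℚ N ℚ.* ℤ→ℚ (ℤ.suc n)          ∎

x/c≤‖T/[cd]*m‖ : ∀ {x c d : ℕ} .{{_ : ℕ.NonZero x}} .{{_ : ℕ.NonZero c}} .{{_ : ℕ.NonZero (c * d)}} T m →
                 InWindow (+ (c * d)) (+ (x * d)) (T ℤ.* + m) → + x / c ℚ.≤ ‖ T / (c * d) ℚ.* ℕ→ℚ m ‖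
x/c≤‖T/[cd]*m‖ {x} {c} {d} T m =
  ≤‖‖-inWindow {N} {+ (x * d)} {T ℤ.* + m} {v} {t ℚ.* ℕ→ℚ m} (ℚP.positive⁻¹ v {{ℚP.normalize-pos x c}})
    Nv≡xd Nr≡Tm
  where
  N = c * d
  v = + x / c
  t = T / N
  open ≡-Reasoning
  Nv≡xd : ℕ→ℚ N ℚ.* v ≡ ℕ→ℚ (x * d)
  Nv≡xd = begin
    ℕ→ℚ (c * d) ℚ.* v      ≡⟨ cong (ℚ._* v) (ℕ→ℚ-homo-* c d) ⟩
    ℕ→ℚ c ℚ.* ℕ→ℚ d ℚ.* v  ≡⟨ swap (ℕ→ℚ c) (ℕ→ℚ d) v ⟩
    ℕ→ℚ c ℚ.* v ℚ.* ℕ→ℚ d  ≡⟨ cong (ℚ._* ℕ→ℚ d) (n*[z/n]≡z (+ x) c) ⟩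
    ℕ→ℚ x ℚ.* ℕ→ℚ d        ≡⟨ ℕ→ℚ-homo-* x d ⟨
    ℕ→ℚ (x * d)            ∎
    where
    swap : ∀ p q r → p ℚ.* q ℚ.* r ≡ p ℚ.* r ℚ.* q
    swap p q r = RingSolver.solve (p ∷ q ∷ r ∷ []) ℚ-ring
  Nr≡Tm : ℕ→ℚ N ℚ.* (t ℚ.* ℕ→ℚ m) ≡ ℤ→ℚ (T ℤ.* + m)
  Nr≡Tm = begin
    ℕ→ℚ N ℚ.* (t ℚ.* ℕ→ℚ m)  ≡⟨ ℚP.*-assoc (ℕ→ℚ N) t (ℕ→ℚ m) ⟨
    ℕ→ℚ N ℚ.* t ℚ.* ℕ→ℚ m    ≡⟨ cong (ℚ._* ℕ→ℚ m) (n*[z/n]≡z T N) ⟩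
    ℤ→ℚ T ℚ.* ℕ→ℚ m          ≡⟨ ℤ→ℚ-homo-* T (+ m) ⟨
    ℤ→ℚ (T ℤ.* + m)          ∎

-- u − w inverts A modulo C = A + B, whatever multiple of C is subtracted.
residue-A : ∀ X C A B u w ℓ g → A ℤ.+ B ≡ C → A ℤ.* u ℤ.+ B ℤ.* w ≡ 1ℤ →
            (X ℤ.* (u ℤ.- w) ℤ.- C ℤ.* ℓ ℤ.* g) ℤ.* A ≡ C ℤ.* ℤ.- (X ℤ.* w ℤ.+ ℓ ℤ.* g ℤ.* A) ℤ.+ X
residue-A X C A B u w ℓ g A+B≡C Au+Bw≡1 = begin
  (X ℤ.* (u ℤ.- w) ℤ.- C ℤ.* ℓ ℤ.* g) ℤ.* A
    ≡⟨ solve (X ∷ C ∷ A ∷ B ∷ u ∷ w ∷ ℓ ∷ g ∷ []) ⟩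
  X ℤ.* (A ℤ.* u ℤ.+ B ℤ.* w) ℤ.- X ℤ.* w ℤ.* (A ℤ.+ B) ℤ.- C ℤ.* ℓ ℤ.* g ℤ.* A
    ≡⟨ cong₂ (λ p q → X ℤ.* p ℤ.- X ℤ.* w ℤ.* q ℤ.- C ℤ.* ℓ ℤ.* g ℤ.* A) Au+Bw≡1 A+B≡C ⟩
  X ℤ.* 1ℤ ℤ.- X ℤ.* w ℤ.* C ℤ.- C ℤ.* ℓ ℤ.* g ℤ.* A
    ≡⟨ solve (X ∷ C ∷ A ∷ w ∷ ℓ ∷ g ∷ []) ⟩
  C ℤ.* ℤ.- (X ℤ.* w ℤ.+ ℓ ℤ.* g ℤ.* A) ℤ.+ X ∎
  where open ≡-Reasoning

residue-B : ∀ X C A B T n → A ℤ.+ B ≡ C → C ≡ X ℤ.+ 1ℤ ℤ.+ X → T ℤ.* A ≡ C ℤ.* n ℤ.+ X →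
            T ℤ.* B ≡ C ℤ.* (T ℤ.- n ℤ.- 1ℤ) ℤ.+ X ℤ.+ 1ℤ
residue-B X C A B T n A+B≡C C≡2X+1 TA≡Cn+X = begin
  T ℤ.* B                                            ≡⟨ solve (T ∷ A ∷ B ∷ []) ⟩
  T ℤ.* (A ℤ.+ B) ℤ.- T ℤ.* A                        ≡⟨ cong₂ (λ p q → T ℤ.* p ℤ.- q) A+B≡C TA≡Cn+X ⟩
  T ℤ.* C ℤ.- (C ℤ.* n ℤ.+ X)                        ≡⟨ solve (X ∷ C ∷ T ∷ n ∷ []) ⟩
  C ℤ.* (T ℤ.- n ℤ.- 1ℤ) ℤ.+ C ℤ.- X                 ≡⟨ cong (λ c → C ℤ.* (T ℤ.- n ℤ.- 1ℤ) ℤ.+ c ℤ.- X) C≡2X+1 ⟩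
  C ℤ.* (T ℤ.- n ℤ.- 1ℤ) ℤ.+ (X ℤ.+ 1ℤ ℤ.+ X) ℤ.- X  ≡⟨ solve (X ∷ C ∷ T ∷ n ∷ []) ⟩
  C ℤ.* (T ℤ.- n ℤ.- 1ℤ) ℤ.+ X ℤ.+ 1ℤ               ∎
  where open ≡-Reasoning

-- g inverts K modulo D, so subtracting C ℓ g from T₀ subtracts C ℓ from T₀ K modulo C D.
residue-K : ∀ X C D K T₀ ℓ ρ g y → T₀ ℤ.* K ℤ.- X ℤ.* D ≡ ρ ℤ.+ ℓ ℤ.* C → K ℤ.* g ℤ.+ D ℤ.* y ≡ 1ℤ →
            (T₀ ℤ.- C ℤ.* ℓ ℤ.* g) ℤ.* K ≡ C ℤ.* D ℤ.* (ℓ ℤ.* y) ℤ.+ X ℤ.* D ℤ.+ ρ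
residue-K X C D K T₀ ℓ ρ g y T₀K-XD≡ρ+ℓC Kg+Dy≡1 = begin
  (T₀ ℤ.- C ℤ.* ℓ ℤ.* g) ℤ.* K
    ≡⟨ solve (X ∷ C ∷ D ∷ K ∷ T₀ ∷ ℓ ∷ g ∷ y ∷ []) ⟩
  (T₀ ℤ.* K ℤ.- X ℤ.* D) ℤ.+ X ℤ.* D ℤ.- C ℤ.* ℓ ℤ.* (K ℤ.* g ℤ.+ D ℤ.* y) ℤ.+ C ℤ.* ℓ ℤ.* D ℤ.* y
    ≡⟨ cong₂ (λ p q → p ℤ.+ X ℤ.* D ℤ.- C ℤ.* ℓ ℤ.* q ℤ.+ C ℤ.* ℓ ℤ.* D ℤ.* y) T₀K-XD≡ρ+ℓC Kg+Dy≡1 ⟩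
  (ρ ℤ.+ ℓ ℤ.* C) ℤ.+ X ℤ.* D ℤ.- C ℤ.* ℓ ℤ.* 1ℤ ℤ.+ C ℤ.* ℓ ℤ.* D ℤ.* y
    ≡⟨ solve (X ∷ C ∷ D ∷ ℓ ∷ ρ ∷ y ∷ []) ⟩
  C ℤ.* D ℤ.* (ℓ ℤ.* y) ℤ.+ X ℤ.* D ℤ.+ ρ ∎
  where open ≡-Reasoning

window-multiplier : ∀ {x d a b k : ℕ} {u w g y : ℤ} → 2 * x ≤ d → a + b ≡ suc (2 * x) →
                    + a ℤ.* u ℤ.+ + b ℤ.* w ≡ 1ℤ → + k ℤ.* g ℤ.+ + d ℤ.* y ≡ 1ℤ →
                    let N = + (suc (2 * x) * d) ; V = + (x * d) in
                    ∃[ T ] (InWindow N V (T ℤ.* + (a * d)) × InWindow N V (T ℤ.* + (b * d)) ×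
                            InWindow N V (T ℤ.* + k))
window-multiplier {x} {d} {a} {b} {k} {u} {w} {g} {y} 2x≤d a+b≡2x+1 au+bw≡1 kg+dy≡1 =
  T , rescale a (inWindow-scale {C} {X} D window-a) , rescale b (inWindow-scale {C} {X} D window-b) ,
  cast window-k
  where
  X = + x
  C = + suc (2 * x)
  D = + d
  A = + a
  B = + b
  K = + k
  T₀ = X ℤ.* (u ℤ.- w)
  e = T₀ ℤ.* K ℤ.- X ℤ.* D
  ℓ = e ℤ./ C
  ρ = e ℤ.% C
  T = T₀ ℤ.- C ℤ.* ℓ ℤ.* g
  n = ℤ.- (X ℤ.* w ℤ.+ ℓ ℤ.* g ℤ.* A)
  C≡2X+1 : C ≡ X ℤ.+ 1ℤ ℤ.+ X
  C≡2X+1 = +[2x+1]≡x+1+x x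
  A+B≡C : A ℤ.+ B ≡ C
  A+B≡C = trans (sym (ℤP.pos-+ a b)) (cong +_ a+b≡2x+1)
  TA≡Cn+X : T ℤ.* A ≡ C ℤ.* n ℤ.+ X
  TA≡Cn+X = residue-A X C A B u w ℓ g A+B≡C au+bw≡1
  window-a : InWindow C X (T ℤ.* A)
  window-a = inWindow n C≡2X+1 ℤP.≤-refl (ℤ.+≤+ ℕ.z≤n) (trans TA≡Cn+X (sym (ℤP.+-identityʳ _)))
  window-b : InWindow C X (T ℤ.* B)
  window-b = inWindow (T ℤ.- n ℤ.- 1ℤ) C≡2X+1 (ℤ.+≤+ ℕ.z≤n) ℤP.≤-refl
    (residue-B X C A B T n A+B≡C C≡2X+1 TA≡Cn+X)
  CD≡XD+D+XD : C ℤ.* D ≡ X ℤ.* D ℤ.+ D ℤ.+ X ℤ.* D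
  CD≡XD+D+XD = trans (cong (ℤ._* D) C≡2X+1) (distrib X D)
    where
    distrib : ∀ X D → (X ℤ.+ 1ℤ ℤ.+ X) ℤ.* D ≡ X ℤ.* D ℤ.+ D ℤ.+ X ℤ.* D
    distrib = solve-∀
  -- ρ < 2x + 1 ≤ d + 1: the only use of the hypothesis d ≥ 2x.
  ρ≤D : + ρ ℤ.≤ D
  ρ≤D = ℤ.+≤+ (ℕP.≤-pred (ℕP.<-≤-trans (ℤ.n%d<d e C) (ℕ.s≤s 2x≤d)))
  window-k : InWindow (C ℤ.* D) (X ℤ.* D) (T ℤ.* K)
  window-k = inWindow (ℓ ℤ.* y) CD≡XD+D+XD (ℤ.+≤+ ℕ.z≤n) ρ≤D
    (residue-K X C D K T₀ ℓ (+ ρ) g y (ℤ.a≡a%n+[a/n]*n e C) kg+dy≡1)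
  cast : ∀ {P} → InWindow (C ℤ.* D) (X ℤ.* D) P → InWindow (+ (suc (2 * x) * d)) (+ (x * d)) P
  cast {P} = subst₂ (λ M V → InWindow M V P) (sym (ℤP.pos-* (suc (2 * x)) d)) (sym (ℤP.pos-* x d))
  rescale : ∀ m → InWindow (C ℤ.* D) (X ℤ.* D) (T ℤ.* + m ℤ.* D) →
            InWindow (+ (suc (2 * x) * d)) (+ (x * d)) (T ℤ.* + (m * d))
  rescale m window = subst (InWindow (+ (suc (2 * x) * d)) (+ (x * d)))
    (trans (ℤP.*-assoc T (+ m) D) (cong (T ℤ.*_) (sym (ℤP.pos-* m d)))) (cast window)

ℕ-bézout⇒ℤ : ∀ m n p q → 1 + q * n ≡ p * m → + m ℤ.* + p ℤ.+ + n ℤ.* ℤ.- + q ≡ 1ℤ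
ℕ-bézout⇒ℤ m n p q 1+qn≡pm = begin
  + m ℤ.* + p ℤ.+ + n ℤ.* ℤ.- + q  ≡⟨ reorder (+ m) (+ n) (+ p) (+ q) ⟩
  + p ℤ.* + m ℤ.- + q ℤ.* + n      ≡⟨ cong₂ ℤ._-_ (ℤP.pos-* p m) (ℤP.pos-* q n) ⟨
  + (p * m) ℤ.- + (q * n)          ≡⟨ cong (λ z → + z ℤ.- + (q * n)) 1+qn≡pm ⟨
  + (1 + q * n) ℤ.- + (q * n)      ≡⟨ cong (ℤ._- + (q * n)) (ℤP.pos-+ 1 (q * n)) ⟩
  1ℤ ℤ.+ + (q * n) ℤ.- + (q * n)   ≡⟨ cancel (+ (q * n)) ⟩
  1ℤ                               ∎
  where
  open ≡-Reasoning
  reorder : ∀ M N P Q → M ℤ.* P ℤ.+ N ℤ.* ℤ.- Q ≡ P ℤ.* M ℤ.- Q ℤ.* N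
  reorder = solve-∀
  cancel : ∀ Z → 1ℤ ℤ.+ Z ℤ.- Z ≡ 1ℤ
  cancel = solve-∀

coprime⇒bézout : ∀ {m n} → Coprime m n → ∃₂ λ u w → + m ℤ.* u ℤ.+ + n ℤ.* w ≡ 1ℤ
coprime⇒bézout {m} {n} m⊥n with coprime-Bézout m⊥n
... | Bézout.+- p q 1+qn≡pm = + p , ℤ.- + q , ℕ-bézout⇒ℤ m n p q 1+qn≡pm
... | Bézout.-+ p q 1+pm≡qn = ℤ.- + p , + q ,
  trans (ℤP.+-comm (+ m ℤ.* ℤ.- + p) (+ n ℤ.* + q)) (ℕ-bézout⇒ℤ n m q p 1+pm≡qn)

a+b≡2x+1⇒x≢0 : ∀ {a b x} .{{_ : ℕ.NonZero a}} .{{_ : ℕ.NonZero b}} → a + b ≡ suc (2 * x) → ℕ.NonZero x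
a+b≡2x+1⇒x≢0 {a} {b} {ℕ.zero} a+b≡1 =
  ⊥-elim (ℕP.<-irrefl refl (subst (2 ≤_) a+b≡1 (ℕP.+-mono-≤ (ℕ.>-nonZero⁻¹ a) (ℕ.>-nonZero⁻¹ b))))
a+b≡2x+1⇒x≢0 {x = suc _} _ = _

minDist-attains : ∀ {a b d k x} .{{_ : ℕ.NonZero a}} .{{_ : ℕ.NonZero b}} .{{_ : ℕ.NonZero d}} →
                  Coprime a b → Coprime k d → a + b ≡ suc (2 * x) → 2 * x ≤ d →
                  ∃[ t ] + x / suc (2 * x) ℚ.≤ minDist (a * d) (b * d) k t
minDist-attains {a} {b} {d} {k} {x} a⊥b k⊥d a+b≡2x+1 2x≤d =
  let instance
        x≢0 : ℕ.NonZero x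
        x≢0 = a+b≡2x+1⇒x≢0 a+b≡2x+1
        N≢0 : ℕ.NonZero (suc (2 * x) * d)
        N≢0 = ℕP.m*n≢0 (suc (2 * x)) d
      u , w , au+bw≡1 = coprime⇒bézout a⊥b
      g , y , kg+dy≡1 = coprime⇒bézout k⊥d
      T , window-ad , window-bd , window-k =
        window-multiplier {x} {d} {a} {b} {k} {u} {w} {g} {y} 2x≤d a+b≡2x+1 au+bw≡1 kg+dy≡1
      far = x/c≤‖T/[cd]*m‖ {x} {suc (2 * x)} {d} T
  in T / (suc (2 * x) * d) ,
     ℚP.⊓-glb (ℚP.⊓-glb (far (a * d) window-ad) (far (b * d) window-bd)) (far k window-k)

isKappa-of-max : ∀ {i j k v} → (∀ t → minDist i j k t ℚ.≤ v) → ∃[ t ] v ℚ.≤ minDist i j k t →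
                 IsKappa i j k v
isKappa-of-max {v = v} upper (t , v≤min) = upper , λ ε ε-pos → t , ℚP.<-≤-trans (v-ε<v ε-pos) v≤min
  where
  v-ε<v : ∀ {ε} → ℚ.Positive ε → v ℚ.- ε ℚ.< v
  v-ε<v {ε} ε-pos = subst (v ℚ.- ε ℚ.<_) (ℚP.+-identityʳ v)
    (ℚP.+-monoʳ-< v (ℚP.neg-antimono-< (ℚP.positive⁻¹ ε {{ε-pos}})))

isKappa[ad,bd,k] : ∀ {a b d k x} .{{_ : ℕ.NonZero a}} .{{_ : ℕ.NonZero b}} .{{_ : ℕ.NonZero d}} →
                   Coprime a b → Coprime k d → a + b ≡ suc (2 * x) → 2 * x ≤ d →
                   IsKappa (a * d) (b * d) k (+ x / suc (2 * x))
isKappa[ad,bd,k] {a} {b} {d} {k} {x} a⊥b k⊥d a+b≡2x+1 2x≤d =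
  isKappa-of-max {a * d} {b * d} {k} upper (minDist-attains {k = k} {x} a⊥b k⊥d a+b≡2x+1 2x≤d)
  where
  s*md≡s*d*m : ∀ s m → s ℚ.* ℕ→ℚ (m * d) ≡ s ℚ.* ℕ→ℚ d ℚ.* ℕ→ℚ m
  s*md≡s*d*m s m = trans (cong (s ℚ.*_) (ℕ→ℚ-homo-* m d)) (reorder s (ℕ→ℚ m) (ℕ→ℚ d))
    where
    reorder : ∀ s p q → s ℚ.* (p ℚ.* q) ≡ s ℚ.* q ℚ.* p
    reorder s p q = RingSolver.solve (s ∷ p ∷ q ∷ []) ℚ-ring
  upper : ∀ t → minDist (a * d) (b * d) k t ℚ.≤ + x / suc (2 * x)
  upper t = ℚP.≤-trans (ℚP.p⊓q≤p _ ‖ t ℚ.* ℕ→ℚ k ‖)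
    (subst (ℚ._≤ + x / suc (2 * x)) (sym (cong₂ (λ p q → ‖ p ‖ ℚ.⊓ ‖ q ‖) (s*md≡s*d*m t a) (s*md≡s*d*m t b)))
      (‖sa‖⊓‖sb‖≤ {x = x} a+b≡2x+1 (t ℚ.* ℕ→ℚ d)))

lemma3 : (i j k x d : ℕ) → .{{_ : NonZero i}} → .{{_ : NonZero j}} → .{{_ : NonZero k}} →
    gcd (gcd i j) k ≡ 1 → d ≡ gcd i j →
    (i + j ≡ d * (2 * x + 1)) → d ≥ 2 * x →
    IsKappa i j k ((+ x) / suc (2 * x))
lemma3 i j k x d gcd[d,k]≡1 refl i+j≡d[2x+1] 2x≤d =
  subst₂ (λ i′ j′ → IsKappa i′ j′ k (+ x / suc (2 * x))) (m/n*n≡m (gcd[m,n]∣m i j)) (m/n*n≡m (gcd[m,n]∣n i j))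
    (isKappa[ad,bd,k] {k = k} {x}
      (coprime-/gcd i j) (gcd≡1⇒coprime (trans (gcd-comm k d) gcd[d,k]≡1)) a+b≡2x+1 2x≤d)
  where
  instance
    d≢0 : ℕ.NonZero d
    d≢0 = ℕ.≢-nonZero (gcd[m,n]≢0 i j (inj₁ (ℕ.≢-nonZero⁻¹ i)))
    a≢0 : ℕ.NonZero (i ℕ./ d)
    a≢0 = ℕ.≢-nonZero (m/gcd[m,n]≢0 i j)
    b≢0 : ℕ.NonZero (j ℕ./ d)
    b≢0 = ℕ.≢-nonZero (n/gcd[m,n]≢0 i j)
  a+b≡2x+1 : i ℕ./ d + j ℕ./ d ≡ suc (2 * x)
  a+b≡2x+1 = ℕP.*-cancelʳ-≡ _ _ d (begin
    (i ℕ./ d + j ℕ./ d) * d    ≡⟨ ℕP.*-distribʳ-+ d (i ℕ./ d) (j ℕ./ d) ⟩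
    i ℕ./ d * d + j ℕ./ d * d  ≡⟨ cong₂ _+_ (m/n*n≡m (gcd[m,n]∣m i j)) (m/n*n≡m (gcd[m,n]∣n i j)) ⟩
    i + j                      ≡⟨ i+j≡d[2x+1] ⟩
    d * (2 * x + 1)            ≡⟨ ℕP.*-comm d (2 * x + 1) ⟩
    (2 * x + 1) * d            ≡⟨ cong (_* d) (ℕP.+-comm (2 * x) 1) ⟩
    suc (2 * x) * d            ∎)
    where open ≡-Reasoning
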